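{- Consider the agglomeration phase of P-RASTER (described in the context) applied to a finite set $S\subset\mathbb{Z}^2$ of significant tiles, with minimum cluster size $\mu$ and arbitrary borders $b_1<\dots<b_{N-1}$. Fix a border $B_i$ ($1\le i\le N-1$) and let $C_1,\dots,C_r$ ($r\ge 2$) be per-slice clusters, each lying in slice $i$ or slice $i+1$, such that $C_1\cup\dots\cup C_r$ is connected in the neighbor graph on $S$ (so that, without the border $B_i$, they would form one single cluster). Then, when the algorithm terminates, $C_1,\dots,C_r$ have all been joined into one and the same joined cluster, regardless of how many such clusters there are and on which side of $B_i$ each of them lies.
   Context: Tiles are integer grid cells $(x,y)\in\mathbb{Z}^2$. Two tiles are neighbors if their Chebyshev distance is exactly $1$ (the eight surrounding cells). For a set of tiles, its clusters are the connected components of the graph on those tiles whose edges join neighboring tiles. Two sets of tiles are adjacent if some tile of one is a neighbor of some tile of the other. P-RASTER agglomeration. Input: a finite set $S$ of significant tiles, a minimum cluster size $\mu$, and integers $b_1<\dots<b_{N-1}$ (vertical borders). Put $b_0=-\infty$, $b_N=+\infty$; slice $k$ ($1\le k\le N$) consists of the tiles of $S$ with $b_{k-1}\le x<b_k$, and border $B_k$ ($1\le k\le N-1$) separates slices $k$ and $k+1$. A set of tiles touches $B_k$ if it contains a tile with $x=b_k-1$ or $x=b_k$. Step 1 (in parallel per slice): compute the clusters of the tiles of each slice (per-slice clusters); a per-slice cluster touching some border is put into the candidate set $C_b$; otherwise it is output if it has at least $\mu$ tiles and discarded otherwise. Step 2 (joining, for $i=N-1,N-2,\dots,1$ in this order):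 let $C_{lr}$ be the clusters in $C_b$ that touch $B_i$; repeatedly merge clusters of $C_{lr}$ that are adjacent (a depth-first search over clusters, merging each newly found adjacent cluster into the current joined cluster) until the elements of $C_{lr}$ are grouped into maximal joined clusters; each joined cluster that touches $B_{i-1}$ is returned to $C_b$ as a candidate for the next border (replacing its constituents), and each other joined cluster is output if it has at least $\mu$ tiles and discarded otherwise. The output is the set of all output clusters. -}

module Defs where

open import Data.Bool using (Bool; true; false; _∧_; _∨_; not; if_then_else_)
open import Data.Nat as ℕ using (ℕ; zero; suc; _⊔_)
open import Data.Integer as ℤ using (ℤ; _-_; ∣_∣; 1ℤ)
open import Data.Product using (_×_; _,_; proj₁; proj₂)
open import Data.Maybe using (Maybe; just; nothing)
open import Data.List using (List; []; _∷_; _++_; length; filterᵇ; concat; map; concatMap; applyUpTo)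
open import Data.List.Membership.Propositional using (_∈_)
open import Data.Bool.ListAction using (any)
open import Relation.Nullary.Decidable using (⌊_⌋)
open import Relation.Binary.PropositionalEquality using (_≡_)

Tile : Set
Tile = ℤ × ℤ

xOf : Tile → ℤ
xOf = proj₁

cheb : Tile → Tile → ℕ
cheb (x , y) (x' , y') = ∣ x - x' ∣ ⊔ ∣ y - y' ∣

Neighbor : Tile → Tile → Set
Neighbor p q = cheb p q ≡ 1

neighborᵇ : Tile → Tile → Bool
neighborᵇ p q = ⌊ cheb p q ℕ.≟ 1 ⌋

data Path (T : List Tile) : Tile → Tile → Set where
  here : ∀ {p} → Path T p p
  step : ∀ {p p' q} → Neighbor p p' → p' ∈ T → Path T p' q → Path T p q

Connected : List Tile → Set
Connected T = ∀ p q → p ∈ T → q ∈ T → Path T p q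

-- Generic connected components of a finite list w.r.t. a boolean
-- adjacency relation (fuel-bounded closure; fuel = length suffices).

module Components {A : Set} (adj : A → A → Bool) where

  grow : ℕ → List A → List A → List A × List A
  grow zero    g rest = g , rest
  grow (suc n) g rest with filterᵇ (λ y → any (λ x → adj x y) g) rest
  ... | []      = g , rest
  ... | new@(_ ∷ _) = grow n (g ++ new) (filterᵇ (λ y → not (any (λ x → adj x y) g)) rest)

  comps : ℕ → List A → List (List A)
  comps zero    _        = []
  comps (suc n) []       = []
  comps (suc n) (x ∷ xs) with grow (length xs) (x ∷ []) xs
  ... | g , r = g ∷ comps n r

  components : List A → List (List A)
  components xs = comps (length xs) xs

-- nth element, 1-based: border bs j = b_j for 1 ≤ j ≤ length bs, nothing otherwise
border : List ℤ → ℕ → Maybe ℤ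
border bs       zero          = nothing
border []       (suc j)       = nothing
border (b ∷ bs) (suc zero)    = just b
border (b ∷ bs) (suc (suc j)) = border bs (suc j)

-- b ≤ x, with nothing meaning -∞
aboveLower : Maybe ℤ → ℤ → Bool
aboveLower nothing  x = true
aboveLower (just b) x = b ℤ.≤ᵇ x

-- x < b, with nothing meaning +∞
belowUpper : Maybe ℤ → ℤ → Bool
belowUpper nothing  x = true
belowUpper (just b) x = not (b ℤ.≤ᵇ x)

-- tiles of S in slice k (1 ≤ k ≤ N = length bs + 1): b_{k-1} ≤ x < b_k
sliceTiles : List Tile → List ℤ → ℕ → List Tile
sliceTiles S bs k =
  filterᵇ (λ t → aboveLower (border bs (k ℕ.∸ 1)) (xOf t) ∧ belowUpper (border bs k) (xOf t)) S

open Components neighborᵇ renaming (components to tileClusters)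

sliceClusters : List Tile → List ℤ → ℕ → List (List Tile)
sliceClusters S bs k = tileClusters (sliceTiles S bs k)

_==ᵇ_ : ℤ → ℤ → Bool
a ==ᵇ b = (a ℤ.≤ᵇ b) ∧ (b ℤ.≤ᵇ a)

touchesAt : ℤ → List Tile → Bool
touchesAt b T = any (λ t → (xOf t ==ᵇ (b - 1ℤ)) ∨ (xOf t ==ᵇ b)) T

touchesB : Maybe ℤ → List Tile → Bool
touchesB nothing  T = false
touchesB (just b) T = touchesAt b T

adjacentᵇ : List Tile → List Tile → Bool
adjacentᵇ C D = any (λ p → any (λ q → neighborᵇ p q) D) C

-- Joined clusters are recorded by their constituent per-slice clusters.

JCluster : Set
JCluster = List (List Tile)

tilesOf : JCluster → List Tile
tilesOf = concat

adjJᵇ : JCluster → JCluster → Bool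
adjJᵇ J K = adjacentᵇ (tilesOf J) (tilesOf K)

bigEnough : ℕ → JCluster → Bool
bigEnough μ J = μ ℕ.≤ᵇ length (tilesOf J)

record State : Set where
  constructor st
  field
    candidates : List JCluster
    outputs    : List JCluster
    discarded  : List JCluster

open State public

step1 : List Tile → ℕ → List ℤ → State
step1 S μ bs = st cb (filterᵇ (bigEnough μ) rest) (filterᵇ (λ J → not (bigEnough μ J)) rest)
  where
    allPS : List JCluster
    allPS = map (λ C → C ∷ []) (concatMap (sliceClusters S bs) (applyUpTo suc (suc (length bs))))
    touchesSome : JCluster → Bool
    touchesSome J = any (λ b → touchesAt b (tilesOf J)) bs
    cb   = filterᵇ touchesSome allPS
    rest = filterᵇ (λ J → not (touchesSome J)) allPS

joinAt : ℕ → List ℤ → ℕ → State → State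
joinAt μ bs i (st cb out disc) =
  st (rest ++ back) (out ++ filterᵇ (bigEnough μ) term) (disc ++ filterᵇ (λ J → not (bigEnough μ J)) term)
  where
    tB : JCluster → Bool
    tB J = touchesB (border bs i) (tilesOf J)
    clr  = filterᵇ tB cb
    rest = filterᵇ (λ J → not (tB J)) cb
    joined : List JCluster
    joined = map concat (Components.components adjJᵇ clr)
    tPrev : JCluster → Bool
    tPrev J = touchesB (border bs (i ℕ.∸ 1)) (tilesOf J)
    back = filterᵇ tPrev joined
    term = filterᵇ (λ J → not (tPrev J)) joined

joinLoop : ℕ → List ℤ → ℕ → State → State
joinLoop μ bs zero    s = s
joinLoop μ bs (suc i) s = joinLoop μ bs i (joinAt μ bs (suc i) s)

praster : List Tile → ℕ → List ℤ → State
praster S μ bs = joinLoop μ bs (length bs) (step1 S μ bs)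

finalClusters : List Tile → ℕ → List ℤ → List JCluster
finalClusters S μ bs = outputs (praster S μ bs) ++ discarded (praster S μ bs)

-- Every candidate present at the join at B_j touches some B_k with k ≤ j, so each candidate ends up
-- inside an output or discarded cluster; it remains to see that all the Cₗ end up in the same one.
-- If some Cₘ does not touch B_i, it has no neighbour across B_i (such a pair of tiles sits at
-- x = b_i - 1 and x = b_i), so by connectivity every Cₗ equals Cₘ. Otherwise every Cₗ touches B_i.
-- Lying left of b_{i+1}, it is ignored by the joins at B_j for j > i+1, and the join at B_{i+1}
-- puts it into a joined cluster that still touches B_i and so comes back as a candidate. At the
-- join at B_i, each neighbour step of a path through ⋃ Cₗ makes the candidates containing its two
-- tiles adjacent, so all these candidates lie in one component, i.e. in one joined cluster.

module Submission where

open import Defs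
open import Data.Bool using (Bool; _∨_; not; T; false; true)
open import Data.Bool.ListAction using (any)
open import Data.Bool.Properties using (T-∧; T-∨)
open import Data.Empty using (⊥-elim)
open import Data.Integer as ℤ using (ℤ; _-_; ∣_∣; 1ℤ; +≤+)
import Data.Integer.Properties as ℤ
open import Data.Integer.Tactic.RingSolver using (solve-∀)
open import Data.List using (List; []; _∷_; _++_; length; filterᵇ; concat; map; concatMap; applyUpTo)
open import Data.List.Properties using (length-filter; filter-notAll; ++-identityʳ)
open import Data.List.Membership.Propositional using (_∈_; _∉_; lose; find)
open import Data.List.Membership.Propositional.Properties
  using (∈-++⁺ˡ; ∈-++⁺ʳ; ∈-++⁻; ∈-filter⁺; ∈-filter⁻; ∈-concat⁺′; ∈-concat⁻′; ∈-map⁺; ∈-applyUpTo⁺)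
open import Data.List.Relation.Binary.Subset.Propositional using (_⊆_)
open import Data.List.Relation.Unary.All as All using (All; _∷_; all?; tabulate)
open import Data.List.Relation.Unary.All.Properties using (¬All⇒Any¬)
open import Data.List.Relation.Unary.Any using (here; there)
open import Data.List.Relation.Unary.Any.Properties using (any⁺; any⁻; concat⁺)
open import Data.List.Relation.Unary.Linked as Linked using (Linked; _∷_)
open import Data.List.Relation.Unary.Unique.Propositional using (Unique; _∷_)
import Data.List.Relation.Unary.Unique.Propositional.Properties as Unique
open import Data.Maybe using (just)
open import Data.Nat as ℕ using (ℕ; zero; suc; _+_; _∸_; _≤_; _<_; z≤n; s≤s; _≟_)
open import Data.Nat.Properties
  using (≤-refl; ≤-trans; ≤-pred; ≤∧≢⇒<; <-trans; m≤m⊔n; m∸n+n≡m; m≤n⇒m≤1+n; m≤n+m; n<1+n)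
open import Data.Product using (∃-syntax; _×_; _,_; proj₁; proj₂)
open import Data.Sum using (_⊎_; inj₁; inj₂)
open import Function using (_∘_; id)
open import Function.Bundles using (Equivalence)
open import Relation.Nullary using (¬_; yes; no)
open import Relation.Nullary.Decidable using (T?; fromWitness; toWitness)
open import Relation.Binary.PropositionalEquality using (_≡_; _≢_; refl; sym; trans; cong; cong₂; subst)

T-not⁺ : ∀ {b} → ¬ T b → T (not b)
T-not⁺ {false} _  = _
T-not⁺ {true}  ¬b = ¬b _

T-not⁻ : ∀ {b} → T (not b) → ¬ T b
T-not⁻ {false} _ ()

module _ {A : Set} (p : A → Bool) where

  ∈-filterᵇ⁺ : ∀ {x xs} → x ∈ xs → T (p x) → x ∈ filterᵇ p xs
  ∈-filterᵇ⁺ = ∈-filter⁺ (T? ∘ p)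

  ∈-filterᵇ⁻ : ∀ xs {x} → x ∈ filterᵇ p xs → x ∈ xs × T (p x)
  ∈-filterᵇ⁻ xs = ∈-filter⁻ (T? ∘ p) {xs = xs}

  ∈⇒T-any : ∀ {x xs} → x ∈ xs → T (p x) → T (any p xs)
  ∈⇒T-any x∈xs px = any⁺ p (lose x∈xs px)

  ∈-filterᵇ-split : ∀ {x xs} → x ∈ xs → x ∈ filterᵇ p xs ⊎ x ∈ filterᵇ (not ∘ p) xs
  ∈-filterᵇ-split {x} x∈xs with T? (p x)
  ... | yes px = inj₁ (∈-filterᵇ⁺ x∈xs px)
  ... | no ¬px = inj₂ (∈-filter⁺ (T? ∘ (not ∘ p)) x∈xs (T-not⁺ ¬px))

  T-any⇒∈ : ∀ xs → T (any p xs) → ∃[ x ] (x ∈ xs × T (p x))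
  T-any⇒∈ xs = find ∘ any⁻ p xs

module ComponentsProperties {A : Set} (adj : A → A → Bool)
                            (adj-sym : ∀ {x y} → T (adj x y) → T (adj y x)) where

  open Components adj

  adjacentTo : List A → A → Bool
  adjacentTo g y = any (λ x → adj x y) g

  ⊆-grown : ∀ n g rest {y} → y ∈ g → y ∈ proj₁ (grow n g rest)
  ⊆-grown zero    g rest y∈g = y∈g
  ⊆-grown (suc n) g rest y∈g with filterᵇ (adjacentTo g) rest
  ... | []          = y∈g
  ... | new@(_ ∷ _) = ⊆-grown n (g ++ new) _ (∈-++⁺ˡ y∈g)

  grown-⊆ : ∀ n g rest {y} → y ∈ proj₁ (grow n g rest) → y ∈ g ⊎ y ∈ rest
  grown-⊆ zero    g rest y∈ = inj₁ y∈
  grown-⊆ (suc n) g rest y∈ with filterᵇ (adjacentTo g) rest in eq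
  ... | []          = inj₁ y∈
  ... | new@(_ ∷ _) with grown-⊆ n (g ++ new) _ y∈
  ...   | inj₂ y∈rest = inj₂ (proj₁ (∈-filterᵇ⁻ (not ∘ adjacentTo g) rest y∈rest))
  ...   | inj₁ y∈g++new with ∈-++⁻ g y∈g++new
  ...     | inj₁ y∈g   = inj₁ y∈g
  ...     | inj₂ y∈new = inj₂ (proj₁ (∈-filterᵇ⁻ (adjacentTo g) rest (subst (_ ∈_) (sym eq) y∈new)))

  rest-⊆ : ∀ n g rest {y} → y ∈ proj₂ (grow n g rest) → y ∈ rest
  rest-⊆ zero    g rest y∈ = y∈
  rest-⊆ (suc n) g rest y∈ with filterᵇ (adjacentTo g) rest
  ... | []          = y∈
  ... | new@(_ ∷ _) = proj₁ (∈-filterᵇ⁻ (not ∘ adjacentTo g) rest (rest-⊆ n (g ++ new) _ y∈))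

  grown-or-rest : ∀ n g rest {y} → y ∈ rest →
                  y ∈ proj₁ (grow n g rest) ⊎ y ∈ proj₂ (grow n g rest)
  grown-or-rest zero    g rest y∈ = inj₂ y∈
  grown-or-rest (suc n) g rest {y} y∈ with filterᵇ (adjacentTo g) rest in eq
  ... | []          = inj₂ y∈
  ... | new@(_ ∷ _) with ∈-filterᵇ-split (adjacentTo g) y∈
  ...   | inj₁ y∈new   = inj₁ (⊆-grown n (g ++ new) _ (∈-++⁺ʳ g (subst (y ∈_) eq y∈new)))
  ...   | inj₂ y∈rest′ = grown-or-rest n (g ++ new) _ y∈rest′

  length-rest : ∀ n g rest → length (proj₂ (grow n g rest)) ≤ length rest
  length-rest zero    g rest = ≤-refl
  length-rest (suc n) g rest with filterᵇ (adjacentTo g) rest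
  ... | []          = ≤-refl
  ... | new@(_ ∷ _) = ≤-trans (length-rest n (g ++ new) _) (length-filter (T? ∘ (not ∘ adjacentTo g)) rest)

  grown-rest-separated : ∀ n g rest → length rest ≤ n → ∀ {x y} →
                         x ∈ proj₁ (grow n g rest) → y ∈ proj₂ (grow n g rest) → ¬ T (adj x y)
  grown-rest-separated zero    g [] _ _ ()
  grown-rest-separated (suc n) g rest _ {x} {y} x∈ y∈ xy with filterᵇ (adjacentTo g) rest in eq
  ... | [] with () ← subst (y ∈_) eq (∈-filterᵇ⁺ (adjacentTo g) y∈ (∈⇒T-any (λ x → adj x y) x∈ xy))
  grown-rest-separated (suc n) g rest rest≤ x∈ y∈ xy | new@(z ∷ _) =
    grown-rest-separated n (g ++ new) _ shorter x∈ y∈ xy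
    where
      z∈ : z ∈ rest × T (adjacentTo g z)
      z∈ = ∈-filterᵇ⁻ (adjacentTo g) rest (subst (z ∈_) (sym eq) (here refl))
      shorter : length (filterᵇ (not ∘ adjacentTo g) rest) ≤ n
      shorter = ≤-pred (≤-trans (filter-notAll (T? ∘ (not ∘ adjacentTo g)) rest
                                   (lose (proj₁ z∈) (λ t → T-not⁻ t (proj₂ z∈)))) rest≤)

  grown-rest-disjoint : ∀ n g rest → (∀ {y} → y ∈ g → y ∉ rest) →
                        ∀ {y} → y ∈ proj₁ (grow n g rest) → y ∉ proj₂ (grow n g rest)
  grown-rest-disjoint zero    g rest g#rest = g#rest
  grown-rest-disjoint (suc n) g rest g#rest with filterᵇ (adjacentTo g) rest in eq
  ... | []          = g#rest
  ... | new@(_ ∷ _) = grown-rest-disjoint n (g ++ new) _ g++new#rest′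
    where
      g++new#rest′ : ∀ {y} → y ∈ g ++ new → y ∉ filterᵇ (not ∘ adjacentTo g) rest
      g++new#rest′ y∈g++new y∈rest′ with ∈-filterᵇ⁻ (not ∘ adjacentTo g) rest y∈rest′ | ∈-++⁻ g y∈g++new
      ... | y∈rest , _       | inj₁ y∈g   = g#rest y∈g y∈rest
      ... | _      , ¬adj-g | inj₂ y∈new =
        T-not⁻ ¬adj-g (proj₂ (∈-filterᵇ⁻ (adjacentTo g) rest (subst (_ ∈_) (sym eq) y∈new)))

  rest-unique : ∀ n g rest → Unique rest → Unique (proj₂ (grow n g rest))
  rest-unique zero    g rest u = u
  rest-unique (suc n) g rest u with filterᵇ (adjacentTo g) rest
  ... | []          = u
  ... | new@(_ ∷ _) = rest-unique n (g ++ new) _ (Unique.filter⁺ (T? ∘ (not ∘ adjacentTo g)) u)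

  private
    seed#rest : ∀ {x : A} {xs} → All (x ≢_) xs → ∀ {y} → y ∈ x ∷ [] → y ∉ xs
    seed#rest x≢xs (here refl) y∈xs = All.lookup x≢xs y∈xs refl

  ∈-comps : ∀ n L → length L ≤ n → ∀ {y} → y ∈ L → ∃[ G ] (G ∈ comps n L × y ∈ G)
  ∈-comps (suc n) (x ∷ xs) _ (here refl) = _ , here refl , ⊆-grown (length xs) (x ∷ []) xs (here refl)
  ∈-comps (suc n) (x ∷ xs) (s≤s xs≤n) (there y∈xs) with grown-or-rest (length xs) (x ∷ []) xs y∈xs
  ... | inj₁ y∈grown = _ , here refl , y∈grown
  ... | inj₂ y∈rest  with ∈-comps n _ (≤-trans (length-rest (length xs) _ xs) xs≤n) y∈rest
  ...   | G , G∈ , y∈G = G , there G∈ , y∈G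

  comps-⊆ : ∀ {n L G y} → G ∈ comps n L → y ∈ G → y ∈ L
  comps-⊆ {suc n} {x ∷ xs} (here refl) y∈G with grown-⊆ (length xs) (x ∷ []) xs y∈G
  ... | inj₁ (here refl) = here refl
  ... | inj₂ y∈xs        = there y∈xs
  comps-⊆ {suc n} {x ∷ xs} (there G∈) y∈G = there (rest-⊆ (length xs) _ xs (comps-⊆ G∈ y∈G))

  comps-nonempty : ∀ {n L G} → G ∈ comps n L → ∃[ x ] (x ∈ G)
  comps-nonempty {suc n} {x ∷ xs} (here refl) = x , ⊆-grown (length xs) (x ∷ []) xs (here refl)
  comps-nonempty {suc n} {x ∷ xs} (there G∈)  = comps-nonempty G∈

  comps-disjoint : ∀ {n L} → Unique L → ∀ {G₁ G₂ y} →
                   G₁ ∈ comps n L → G₂ ∈ comps n L → y ∈ G₁ → y ∈ G₂ → G₁ ≡ G₂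
  comps-disjoint {suc n} {x ∷ xs} _ (here refl) (here refl) _ _ = refl
  comps-disjoint {suc n} {x ∷ xs} (x≢xs ∷ _) (here refl) (there G₂∈) y∈G₁ y∈G₂ =
    ⊥-elim (grown-rest-disjoint (length xs) (x ∷ []) xs (seed#rest x≢xs) y∈G₁ (comps-⊆ G₂∈ y∈G₂))
  comps-disjoint {suc n} {x ∷ xs} (x≢xs ∷ _) (there G₁∈) (here refl) y∈G₁ y∈G₂ =
    ⊥-elim (grown-rest-disjoint (length xs) (x ∷ []) xs (seed#rest x≢xs) y∈G₂ (comps-⊆ G₁∈ y∈G₁))
  comps-disjoint {suc n} {x ∷ xs} (_ ∷ u) (there G₁∈) (there G₂∈) y∈G₁ y∈G₂ =
    comps-disjoint (rest-unique (length xs) _ xs u) G₁∈ G₂∈ y∈G₁ y∈G₂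

  comps-closed : ∀ n L → length L ≤ n → ∀ {G x y} →
                 G ∈ comps n L → x ∈ G → y ∈ L → T (adj x y) → y ∈ G
  comps-closed (suc n) (x₀ ∷ xs) _ (here refl) _ (here refl) _ =
    ⊆-grown (length xs) (x₀ ∷ []) xs (here refl)
  comps-closed (suc n) (x₀ ∷ xs) _ (here refl) x∈G (there y∈xs) xy
    with grown-or-rest (length xs) (x₀ ∷ []) xs y∈xs
  ... | inj₁ y∈grown = y∈grown
  ... | inj₂ y∈rest  = ⊥-elim (grown-rest-separated (length xs) _ xs ≤-refl x∈G y∈rest xy)
  comps-closed (suc n) (x₀ ∷ xs) (s≤s xs≤n) (there G∈) x∈G y∈L xy with y∈L
  ... | here refl =
    ⊥-elim (grown-rest-separated (length xs) _ xs ≤-refl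
              (⊆-grown (length xs) (x₀ ∷ []) xs (here refl)) (comps-⊆ G∈ x∈G) (adj-sym xy))
  ... | there y∈xs with grown-or-rest (length xs) (x₀ ∷ []) xs y∈xs
  ...   | inj₁ y∈grown =
          ⊥-elim (grown-rest-separated (length xs) _ xs ≤-refl y∈grown (comps-⊆ G∈ x∈G) (adj-sym xy))
  ...   | inj₂ y∈rest  =
          comps-closed n _ (≤-trans (length-rest (length xs) _ xs) xs≤n) G∈ x∈G y∈rest xy

  ∈-components : ∀ L {y} → y ∈ L → ∃[ G ] (G ∈ components L × y ∈ G)
  ∈-components L = ∈-comps (length L) L ≤-refl

  components-closed : ∀ L {G x y} → G ∈ components L → x ∈ G → y ∈ L → T (adj x y) → y ∈ G
  components-closed L = comps-closed (length L) L ≤-refl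

cheb-sym : ∀ p q → cheb p q ≡ cheb q p
cheb-sym (x , y) (x' , y') = cong₂ ℕ._⊔_ (ℤ.∣i-j∣≡∣j-i∣ x x') (ℤ.∣i-j∣≡∣j-i∣ y y')

Neighbor-sym : ∀ {p q} → Neighbor p q → Neighbor q p
Neighbor-sym {p} {q} pq = trans (cheb-sym q p) pq

Neighbor⇒neighborᵇ : ∀ {p q} → Neighbor p q → T (neighborᵇ p q)
Neighbor⇒neighborᵇ = fromWitness

neighborᵇ-sym : ∀ {p q} → T (neighborᵇ p q) → T (neighborᵇ q p)
neighborᵇ-sym {p} {q} = fromWitness ∘ Neighbor-sym {p} {q} ∘ toWitness

==ᵇ-refl : ∀ x → T (x ==ᵇ x)
==ᵇ-refl x = Equivalence.from (T-∧ {x ℤ.≤ᵇ x}) (x≤ᵇx , x≤ᵇx)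
  where
    x≤ᵇx : T (x ℤ.≤ᵇ x)
    x≤ᵇx = ℤ.≤⇒≤ᵇ (ℤ.≤-refl {x})

==ᵇ⇒≡ : ∀ {x y} → T (x ==ᵇ y) → x ≡ y
==ᵇ⇒≡ x==y with Equivalence.to T-∧ x==y
... | x≤y , y≤x = ℤ.≤-antisym (ℤ.≤ᵇ⇒≤ x≤y) (ℤ.≤ᵇ⇒≤ y≤x)

onBorderᵇ : ℤ → Tile → Bool
onBorderᵇ b t = (xOf t ==ᵇ (b - 1ℤ)) ∨ (xOf t ==ᵇ b)

onBorder-left : ∀ {b} t → xOf t ≡ b - 1ℤ → T (onBorderᵇ b t)
onBorder-left t refl = Equivalence.from T-∨ (inj₁ (==ᵇ-refl (xOf t)))

onBorder-right : ∀ {b} t → xOf t ≡ b → T (onBorderᵇ b t)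
onBorder-right t refl = Equivalence.from T-∨ (inj₂ (==ᵇ-refl (xOf t)))

¬onBorder-beyond : ∀ {a b} t → xOf t ℤ.< a → a ℤ.< b → ¬ T (onBorderᵇ b t)
¬onBorder-beyond {a} {b} t x<a a<b on with Equivalence.to T-∨ on
... | inj₁ x==b-1 = ℤ.<-irrefl refl (ℤ.≤-<-trans a≤x x<a)
  where
    open ℤ.≤-Reasoning
    a≤x = begin
      a          ≤⟨ ℤ.i<j⇒i≤pred[j] a<b ⟩
      ℤ.pred b   ≡⟨ ℤ.+-comm ℤ.-1ℤ b ⟩
      b - 1ℤ     ≡⟨ sym (==ᵇ⇒≡ x==b-1) ⟩
      xOf t      ∎
... | inj₂ x==b   = ℤ.<-irrefl refl (ℤ.<-trans (subst (ℤ._< a) (==ᵇ⇒≡ x==b) x<a) a<b)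

private
  x≡[x-y]+y : ∀ x y → x ≡ (x - y) ℤ.+ y
  x≡[x-y]+y = solve-∀

  x≡[1+x]-1 : ∀ x → x ≡ (1ℤ ℤ.+ x) - 1ℤ
  x≡[1+x]-1 = solve-∀

unit-step-across : ∀ {x x' b} → x ℤ.< b → b ℤ.≤ x' → ∣ x - x' ∣ ℕ.≤ 1 → x ≡ b - 1ℤ × x' ≡ b
unit-step-across {x} {x'} {b} x<b b≤x' ∣x-x'∣≤1 = x≡b-1 , ℤ.≤-antisym (ℤ.≤-trans x'≤1+x 1+x≤b) b≤x'
  where
    open ℤ.≤-Reasoning
    1+x≤b : 1ℤ ℤ.+ x ℤ.≤ b
    1+x≤b = ℤ.i<j⇒suc[i]≤j x<b
    x'≤1+x : x' ℤ.≤ 1ℤ ℤ.+ x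
    x'≤1+x = begin
      x'               ≡⟨ x≡[x-y]+y x' x ⟩
      (x' - x) ℤ.+ x    ≤⟨ ℤ.+-monoˡ-≤ x (subst (ℤ._≤ 1ℤ) (ℤ.∣-∣-≤ (ℤ.≤-trans (ℤ.<⇒≤ x<b) b≤x')) (+≤+ ∣x-x'∣≤1)) ⟩
      1ℤ ℤ.+ x         ∎
    x≡b-1 : x ≡ b - 1ℤ
    x≡b-1 = trans (x≡[1+x]-1 x) (cong (_- 1ℤ) (ℤ.≤-antisym 1+x≤b (ℤ.≤-trans b≤x' x'≤1+x)))

border-just : ∀ bs k → 1 ℕ.≤ k → k ℕ.≤ length bs → ∃[ b ] (border bs k ≡ just b)
border-just (c ∷ cs) (suc zero)    _ _          = c , refl
border-just (c ∷ cs) (suc (suc k)) _ (s≤s k≤cs) = border-just cs (suc k) (s≤s z≤n) k≤cs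

border-∈ : ∀ bs k {b} → border bs k ≡ just b → b ∈ bs
border-∈ (c ∷ cs) (suc zero)    refl = here refl
border-∈ (c ∷ cs) (suc (suc k)) eq   = there (border-∈ cs (suc k) eq)

∈⇒border : ∀ bs {b} → b ∈ bs → ∃[ k ] (k ℕ.≤ length bs × border bs k ≡ just b)
∈⇒border (c ∷ cs) (here refl) = 1 , s≤s z≤n , refl
∈⇒border (c ∷ cs) (there b∈cs) with ∈⇒border cs b∈cs
... | suc k , k≤cs , eq = suc (suc k) , s≤s k≤cs , eq

private
  head<border : ∀ {c cs j b} → Linked ℤ._<_ (c ∷ cs) → border cs (suc j) ≡ just b → c ℤ.< b
  head<border {cs = d ∷ ds} {zero}  (c<d ∷ _)  refl = c<d
  head<border {cs = d ∷ ds} {suc j} (c<d ∷ ds↑) eq  = ℤ.<-trans c<d (head<border ds↑ eq)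

border-increasing : ∀ {bs} → Linked ℤ._<_ bs → ∀ k j {b} → 1 ℕ.≤ k → k ℕ.< j → border bs j ≡ just b →
                    ∃[ a ] (border bs k ≡ just a × a ℤ.< b)
border-increasing {c ∷ cs} bs↑ (suc zero)    (suc zero)    _ (s≤s ()) _
border-increasing {c ∷ cs} bs↑ (suc zero)    (suc (suc j)) _ _         eq = c , refl , head<border bs↑ eq
border-increasing {c ∷ cs} bs↑ (suc (suc k)) (suc (suc j)) _ (s≤s k<j) eq =
  border-increasing (Linked.tail bs↑) (suc k) (suc j) (s≤s z≤n) k<j eq

module _ (S : List Tile) (bs : List ℤ) where

  private
    slice-bounds : ∀ {k t} → t ∈ sliceTiles S bs k →
                   T (aboveLower (border bs (k ∸ 1)) (xOf t)) × T (belowUpper (border bs k) (xOf t))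
    slice-bounds t∈ = Equivalence.to T-∧ (proj₂ (∈-filterᵇ⁻ _ S t∈))

  slice-upper : ∀ {k b t} → border bs k ≡ just b → t ∈ sliceTiles S bs k → xOf t ℤ.< b
  slice-upper {k} {t = t} eq t∈ =
    ℤ.≰⇒> (T-not⁻ (subst (λ m → T (belowUpper m (xOf t))) eq (proj₂ (slice-bounds {k} t∈))) ∘ ℤ.≤⇒≤ᵇ)

  slice-lower : ∀ {k b t} → border bs k ≡ just b → t ∈ sliceTiles S bs (suc k) → b ℤ.≤ xOf t
  slice-lower {k} {t = t} eq t∈ =
    ℤ.≤ᵇ⇒≤ (subst (λ m → T (aboveLower m (xOf t))) eq (proj₁ (slice-bounds {suc k} t∈)))

  sliceTiles-disjoint : ∀ {k b t} → border bs k ≡ just b →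
                        t ∈ sliceTiles S bs k → ¬ t ∈ sliceTiles S bs (suc k)
  sliceTiles-disjoint {k} eq t∈k t∈k+1 =
    ℤ.<-irrefl refl (ℤ.<-≤-trans (slice-upper {k} eq t∈k) (slice-lower {k} eq t∈k+1))

  neighbors-across-border : ∀ {k b t t'} → border bs k ≡ just b →
                            t ∈ sliceTiles S bs k → t' ∈ sliceTiles S bs (suc k) → Neighbor t t' →
                            xOf t ≡ b - 1ℤ × xOf t' ≡ b
  neighbors-across-border {k} {t = x , y} {x' , y'} eq t∈ t'∈ tt' =
    unit-step-across (slice-upper {k} eq t∈) (slice-lower {k} eq t'∈)
                     (subst (∣ x - x' ∣ ℕ.≤_) tt' (m≤m⊔n ∣ x - x' ∣ ∣ y - y' ∣))

  sliceTiles-unique : Unique S → ∀ k → Unique (sliceTiles S bs k)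
  sliceTiles-unique S! k = Unique.filter⁺ _ S!

touchesB-concat : ∀ m {C J} → T (touchesB m C) → C ∈ J → T (touchesB m (tilesOf J))
touchesB-concat (just b) {C} touches C∈J = any⁺ _ (concat⁺ (lose C∈J (any⁻ _ C touches)))

adjacentᵇ-intro : ∀ {C D p q} → p ∈ C → q ∈ D → T (neighborᵇ p q) → T (adjacentᵇ C D)
adjacentᵇ-intro {D = D} {p} p∈C q∈D pq = ∈⇒T-any _ p∈C (∈⇒T-any (neighborᵇ p) q∈D pq)

adjacentᵇ-sym : ∀ {C D} → T (adjacentᵇ C D) → T (adjacentᵇ D C)
adjacentᵇ-sym {C} {D} CD with T-any⇒∈ _ C CD
... | p , p∈C , pD with T-any⇒∈ (neighborᵇ p) D pD
...   | q , q∈D , pq = adjacentᵇ-intro q∈D p∈C (neighborᵇ-sym {p} pq)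

module TileComponents = ComponentsProperties neighborᵇ (λ {p} {q} → neighborᵇ-sym {p} {q})
module JoinComponents = ComponentsProperties adjJᵇ (λ {J} {K} → adjacentᵇ-sym {tilesOf J} {tilesOf K})

module Agglomeration (S : List Tile) (μ : ℕ) (bs : List ℤ) where

  touchesᵇ : ℕ → JCluster → Bool
  touchesᵇ j J = touchesB (border bs j) (tilesOf J)

  finished : State → List JCluster
  finished s = outputs s ++ discarded s

  joinedAt : ℕ → List JCluster → List JCluster
  joinedAt j cb = map concat (Components.components adjJᵇ (filterᵇ (touchesᵇ j) cb))

  module _ (j : ℕ) (s : State) where

    private
      cb : List JCluster
      cb = candidates s

    joinAt-untouched : ∀ {J} → J ∈ cb → ¬ T (touchesᵇ j J) → J ∈ candidates (joinAt μ bs j s)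
    joinAt-untouched J∈ ¬touches = ∈-++⁺ˡ (∈-filterᵇ⁺ (not ∘ touchesᵇ j) J∈ (T-not⁺ ¬touches))

    joinAt-returned : ∀ {J} → J ∈ joinedAt j cb → T (touchesᵇ (j ∸ 1) J) → J ∈ candidates (joinAt μ bs j s)
    joinAt-returned J∈ touches = ∈-++⁺ʳ (filterᵇ (not ∘ touchesᵇ j) cb) (∈-filterᵇ⁺ (touchesᵇ (j ∸ 1)) J∈ touches)

    joinAt-joined : ∀ {J} → J ∈ joinedAt j cb → J ∈ candidates (joinAt μ bs j s) ⊎ J ∈ finished (joinAt μ bs j s)
    joinAt-joined {J} J∈ with T? (touchesᵇ (j ∸ 1) J)
    ... | yes touches = inj₁ (joinAt-returned J∈ touches)
    ... | no ¬touches with ∈-filterᵇ-split (bigEnough μ) (∈-filterᵇ⁺ (not ∘ touchesᵇ (j ∸ 1)) J∈ (T-not⁺ ¬touches))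
    ...   | inj₁ J∈out  = inj₂ (∈-++⁺ˡ (∈-++⁺ʳ (outputs s) J∈out))
    ...   | inj₂ J∈disc = inj₂ (∈-++⁺ʳ (outputs s ++ _) (∈-++⁺ʳ (discarded s) J∈disc))

    joinAt-keeps-finished : ∀ {J} → J ∈ finished s → J ∈ finished (joinAt μ bs j s)
    joinAt-keeps-finished J∈ with ∈-++⁻ (outputs s) J∈
    ... | inj₁ J∈out  = ∈-++⁺ˡ (∈-++⁺ˡ J∈out)
    ... | inj₂ J∈disc = ∈-++⁺ʳ (outputs s ++ _) (∈-++⁺ˡ J∈disc)

    candidates-joinAt : ∀ {J} → J ∈ candidates (joinAt μ bs j s) →
                        (J ∈ cb × ¬ T (touchesᵇ j J)) ⊎ (J ∈ joinedAt j cb × T (touchesᵇ (j ∸ 1) J))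
    candidates-joinAt J∈ with ∈-++⁻ (filterᵇ (not ∘ touchesᵇ j) cb) J∈
    ... | inj₁ J∈rest with ∈-filterᵇ⁻ (not ∘ touchesᵇ j) cb J∈rest
    ...   | J∈cb , ¬touches = inj₁ (J∈cb , T-not⁻ ¬touches)
    candidates-joinAt J∈ | inj₂ J∈back = inj₂ (∈-filterᵇ⁻ (touchesᵇ (j ∸ 1)) (joinedAt j cb) J∈back)

    joinAt-absorbs : ∀ {J} → J ∈ cb → ∃[ J' ] (J ⊆ J' ×
                     (J' ∈ candidates (joinAt μ bs j s) ⊎ J' ∈ joinedAt j cb))
    joinAt-absorbs {J} J∈ with T? (touchesᵇ j J)
    ... | no ¬touches = J , id , inj₁ (joinAt-untouched J∈ ¬touches)
    ... | yes touches with JoinComponents.∈-components _ (∈-filterᵇ⁺ (touchesᵇ j) J∈ touches)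
    ...   | G , G∈ , J∈G = concat G , (λ C∈J → ∈-concat⁺′ C∈J J∈G) , inj₂ (∈-map⁺ concat G∈)

  joinAt-survives : ∀ j s {J} → J ∈ candidates s ⊎ J ∈ finished s →
                    ∃[ J' ] (J ⊆ J' × (J' ∈ candidates (joinAt μ bs j s) ⊎ J' ∈ finished (joinAt μ bs j s)))
  joinAt-survives j s (inj₂ J∈) = _ , id , inj₂ (joinAt-keeps-finished j s J∈)
  joinAt-survives j s (inj₁ J∈) with joinAt-absorbs j s J∈
  ... | J' , J⊆J' , inj₁ J'∈ = J' , J⊆J' , inj₁ J'∈
  ... | J' , J⊆J' , inj₂ J'∈ = J' , J⊆J' , joinAt-joined j s J'∈

  CandidatesTouch≤ : ℕ → State → Set
  CandidatesTouch≤ j s = ∀ {J} → J ∈ candidates s → ∃[ k ] (k ≤ j × T (touchesᵇ k J))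

  joinAt-touch≤ : ∀ j s → CandidatesTouch≤ (suc j) s → CandidatesTouch≤ j (joinAt μ bs (suc j) s)
  joinAt-touch≤ j s touch≤ J∈ with candidates-joinAt (suc j) s J∈
  ... | inj₂ (_ , touches) = j , ≤-refl , touches
  ... | inj₁ (J∈cb , ¬touches) with touch≤ J∈cb
  ...   | k , k≤1+j , touchesₖ with k ≟ suc j
  ...     | yes refl = ⊥-elim (¬touches touchesₖ)
  ...     | no k≢1+j = k , ≤-pred (≤∧≢⇒< k≤1+j k≢1+j) , touchesₖ

  -- There is no border B₀ (touchesB nothing = false), so CandidatesTouch≤ 0 s says that s has no candidates.
  ends-in-finished : ∀ j s → CandidatesTouch≤ j s → ∀ {J} → J ∈ candidates s ⊎ J ∈ finished s →
                     ∃[ F ] (F ∈ finished (joinLoop μ bs j s) × J ⊆ F)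
  ends-in-finished zero    s touch≤ (inj₁ J∈) with touch≤ J∈
  ... | zero , _ , ()
  ends-in-finished zero    s touch≤ (inj₂ J∈) = _ , J∈ , id
  ends-in-finished (suc j) s touch≤ J∈ with joinAt-survives (suc j) s J∈
  ... | J' , J⊆J' , J'∈ with ends-in-finished j _ (joinAt-touch≤ j s touch≤) J'∈
  ...   | F , F∈ , J'⊆F = F , F∈ , J'⊆F ∘ J⊆J'

  ends-in-finished-after : ∀ {j} → 1 ≤ j → ∀ s → CandidatesTouch≤ j s → ∀ {J} →
                           J ∈ candidates (joinAt μ bs j s) ⊎ J ∈ finished (joinAt μ bs j s) →
                           ∃[ F ] (F ∈ finished (joinLoop μ bs j s) × J ⊆ F)
  ends-in-finished-after {suc j} _ s touch≤ = ends-in-finished j _ (joinAt-touch≤ j s touch≤)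

  perSliceClusters : List JCluster
  perSliceClusters = map (_∷ []) (concatMap (sliceClusters S bs) (applyUpTo suc (suc (length bs))))

  ∈-perSliceClusters : ∀ k {C} → 1 ≤ k → k ≤ suc (length bs) → C ∈ sliceClusters S bs k →
                       (C ∷ []) ∈ perSliceClusters
  ∈-perSliceClusters (suc k) _ k≤ C∈ =
    ∈-map⁺ (_∷ []) (∈-concat⁺′ C∈ (∈-map⁺ (sliceClusters S bs) (∈-applyUpTo⁺ suc k≤)))

  private
    touchesSome : JCluster → Bool
    touchesSome J = any (λ b → touchesAt b (tilesOf J)) bs

  step1-candidate : ∀ k {J} → J ∈ perSliceClusters → T (touchesᵇ k J) → J ∈ candidates (step1 S μ bs)
  step1-candidate k J∈ touches with border bs k in eq
  ... | just b = ∈-filterᵇ⁺ touchesSome J∈ (∈⇒T-any _ (border-∈ bs k eq) touches)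

  step1-covers : ∀ {J} → J ∈ perSliceClusters → J ∈ candidates (step1 S μ bs) ⊎ J ∈ finished (step1 S μ bs)
  step1-covers J∈ with ∈-filterᵇ-split touchesSome J∈
  ... | inj₁ J∈cb   = inj₁ J∈cb
  ... | inj₂ J∈rest with ∈-filterᵇ-split (bigEnough μ) J∈rest
  ...   | inj₁ J∈out  = inj₂ (∈-++⁺ˡ J∈out)
  ...   | inj₂ J∈disc = inj₂ (∈-++⁺ʳ _ J∈disc)

  step1-touch≤ : CandidatesTouch≤ (length bs) (step1 S μ bs)
  step1-touch≤ {J} J∈ with T-any⇒∈ _ bs (proj₂ (∈-filterᵇ⁻ touchesSome perSliceClusters J∈))
  ... | b , b∈bs , touches with ∈⇒border bs b∈bs
  ...   | k , k≤ , eq = k , k≤ , subst (λ m → T (touchesB m (tilesOf J))) (sym eq) touches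

sliceCluster-⊆ : ∀ S bs k {C t} → C ∈ sliceClusters S bs k → t ∈ C → t ∈ sliceTiles S bs k
sliceCluster-⊆ S bs k = TileComponents.comps-⊆

sliceCluster-¬touches-later : ∀ S {bs} → Linked ℤ._<_ bs → ∀ k j {C} → 1 ≤ k → k ℕ.< j →
                              C ∈ sliceClusters S bs k → ¬ T (touchesB (border bs j) C)
sliceCluster-¬touches-later S {bs} bs↑ k j 1≤k k<j C∈ touches with border bs j in eq
... | just bⱼ with border-increasing bs↑ k j 1≤k k<j eq | T-any⇒∈ (onBorderᵇ bⱼ) _ touches
...   | a , eqₖ , a<bⱼ | t , t∈C , t-on =
        ¬onBorder-beyond t (slice-upper S bs {k} eqₖ (sliceCluster-⊆ S bs k C∈ t∈C)) a<bⱼ t-on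

Path-preserves : ∀ {T} (P : Tile → Set) → (∀ {p p'} → P p → Neighbor p p' → p' ∈ T → P p') →
                 ∀ {p q} → Path T p q → P p → P q
Path-preserves P preserve here                 Pp = Pp
Path-preserves P preserve (step pp' p'∈ path) Pp = Path-preserves P preserve path (preserve Pp pp' p'∈)

module ConnectedFamily (Cs : List (List Tile))
                       (tile-determines : ∀ {C C' t} → C ∈ Cs → C' ∈ Cs → t ∈ C → t ∈ C' → C ≡ C')
                       (nonempty : ∀ {C} → C ∈ Cs → ∃[ t ] (t ∈ C))
                       (connected : Connected (concat Cs)) where

  propagate : (Q : List Tile → Set) →
              (∀ {C C' p p'} → C ∈ Cs → C' ∈ Cs → p ∈ C → p' ∈ C' → Neighbor p p' → Q C → Q C') →
              ∀ {C₀} → C₀ ∈ Cs → Q C₀ → ∀ {C} → C ∈ Cs → Q C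
  propagate Q preserve {C₀} C₀∈ QC₀ {C} C∈ =
    let t₀ , t₀∈C₀        = nonempty C₀∈
        t , t∈C          = nonempty C∈
        C' , C'∈ , t∈C' , QC' = Path-preserves P preserve′ (connected t₀ t (∈-concat⁺′ t₀∈C₀ C₀∈) (∈-concat⁺′ t∈C C∈))
                                                (C₀ , C₀∈ , t₀∈C₀ , QC₀)
    in subst Q (tile-determines C'∈ C∈ t∈C' t∈C) QC'
    where
      P : Tile → Set
      P p = ∃[ C ] (C ∈ Cs × p ∈ C × Q C)
      preserve′ : ∀ {p p'} → P p → Neighbor p p' → p' ∈ concat Cs → P p'
      preserve′ (C , C∈ , p∈C , QC) pp' p'∈ with ∈-concat⁻′ Cs p'∈
      ... | C' , p'∈C' , C'∈ = C' , C'∈ , p'∈C' , preserve C∈ C'∈ p∈C p'∈C' pp' QC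

  within-one-component : ∀ L → (∀ {C} → C ∈ Cs → ∃[ J ] (J ∈ L × C ∈ J)) → ∀ {C₀} → C₀ ∈ Cs →
                         ∃[ G ] (G ∈ Components.components adjJᵇ L × (∀ {C} → C ∈ Cs → C ∈ concat G))
  within-one-component L covered C₀∈ with covered C₀∈
  ... | J₀ , J₀∈L , C₀∈J₀ with JoinComponents.∈-components L J₀∈L
  ...   | G , G∈ , J₀∈G = G , G∈ , λ C∈ → in-G (propagate InG preserve C₀∈ (J₀ , J₀∈G , C₀∈J₀) C∈)
    where
      InG : List Tile → Set
      InG C = ∃[ J ] (J ∈ G × C ∈ J)
      in-G : ∀ {C} → InG C → C ∈ concat G
      in-G (J , J∈G , C∈J) = ∈-concat⁺′ C∈J J∈G
      preserve : ∀ {C C' p p'} → C ∈ Cs → C' ∈ Cs → p ∈ C → p' ∈ C' → Neighbor p p' → InG C → InG C'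
      preserve {p = p} {p'} _ C'∈ p∈C p'∈C' pp' (J , J∈G , C∈J) with covered C'∈
      ... | J' , J'∈L , C'∈J' =
        J' , JoinComponents.components-closed L G∈ J∈G J'∈L
               (adjacentᵇ-intro (∈-concat⁺′ p∈C C∈J) (∈-concat⁺′ p'∈C' C'∈J') (Neighbor⇒neighborᵇ {p} {p'} pp')) ,
        C'∈J'

module AtBorder (S : List Tile) (S! : Unique S) (μ : ℕ) (bs : List ℤ) (bs↑ : Linked ℤ._<_ bs)
                (i : ℕ) (1≤i : 1 ≤ i) (i≤N : i ≤ length bs) where

  open Agglomeration S μ bs

  InPair : List Tile → Set
  InPair C = C ∈ sliceClusters S bs i ⊎ C ∈ sliceClusters S bs (suc i)

  TouchesBᵢ : List Tile → Set
  TouchesBᵢ C = T (touchesB (border bs i) C)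

  private
    bᵢ : ℤ
    bᵢ = proj₁ (border-just bs i 1≤i i≤N)

    border-i : border bs i ≡ just bᵢ
    border-i = proj₂ (border-just bs i 1≤i i≤N)

    onBorder⇒TouchesBᵢ : ∀ {C p} → p ∈ C → T (onBorderᵇ bᵢ p) → TouchesBᵢ C
    onBorder⇒TouchesBᵢ p∈C on = subst (λ m → T (touchesB m _)) (sym border-i) (∈⇒T-any _ p∈C on)

  inPair-disjoint : ∀ {C C' t} → InPair C → InPair C' → t ∈ C → t ∈ C' → C ≡ C'
  inPair-disjoint (inj₁ C∈) (inj₁ C'∈) t∈C t∈C' =
    TileComponents.comps-disjoint (sliceTiles-unique S bs S! i) C∈ C'∈ t∈C t∈C'
  inPair-disjoint (inj₂ C∈) (inj₂ C'∈) t∈C t∈C' =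
    TileComponents.comps-disjoint (sliceTiles-unique S bs S! (suc i)) C∈ C'∈ t∈C t∈C'
  inPair-disjoint (inj₁ C∈) (inj₂ C'∈) t∈C t∈C' =
    ⊥-elim (sliceTiles-disjoint S bs {i} border-i (sliceCluster-⊆ S bs i C∈ t∈C) (sliceCluster-⊆ S bs (suc i) C'∈ t∈C'))
  inPair-disjoint (inj₂ C∈) (inj₁ C'∈) t∈C t∈C' =
    ⊥-elim (sliceTiles-disjoint S bs {i} border-i (sliceCluster-⊆ S bs i C'∈ t∈C') (sliceCluster-⊆ S bs (suc i) C∈ t∈C))

  inPair-nonempty : ∀ {C} → InPair C → ∃[ t ] (t ∈ C)
  inPair-nonempty (inj₁ C∈) = TileComponents.comps-nonempty C∈
  inPair-nonempty (inj₂ C∈) = TileComponents.comps-nonempty C∈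

  inPair-closed : ∀ {C C' p p'} → InPair C → InPair C' → p ∈ C → p' ∈ C' → Neighbor p p' →
                  p' ∈ C ⊎ TouchesBᵢ C
  inPair-closed {p = p} {p'} (inj₁ C∈) (inj₁ C'∈) p∈C p'∈C' pp' =
    inj₁ (TileComponents.components-closed _ C∈ p∈C (sliceCluster-⊆ S bs i C'∈ p'∈C') (Neighbor⇒neighborᵇ {p} {p'} pp'))
  inPair-closed {p = p} {p'} (inj₂ C∈) (inj₂ C'∈) p∈C p'∈C' pp' =
    inj₁ (TileComponents.components-closed _ C∈ p∈C (sliceCluster-⊆ S bs (suc i) C'∈ p'∈C') (Neighbor⇒neighborᵇ {p} {p'} pp'))
  inPair-closed {p = p} (inj₁ C∈) (inj₂ C'∈) p∈C p'∈C' pp' =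
    inj₂ (onBorder⇒TouchesBᵢ p∈C (onBorder-left p (proj₁ (neighbors-across-border S bs {i} border-i
           (sliceCluster-⊆ S bs i C∈ p∈C) (sliceCluster-⊆ S bs (suc i) C'∈ p'∈C') pp'))))
  inPair-closed {p = p} {p'} (inj₂ C∈) (inj₁ C'∈) p∈C p'∈C' pp' =
    inj₂ (onBorder⇒TouchesBᵢ p∈C (onBorder-right p (proj₂ (neighbors-across-border S bs {i} border-i
           (sliceCluster-⊆ S bs i C'∈ p'∈C') (sliceCluster-⊆ S bs (suc i) C∈ p∈C) (Neighbor-sym {p} {p'} pp')))))

  inPair-singleton : ∀ {C} → InPair C → (C ∷ []) ∈ perSliceClusters
  inPair-singleton (inj₁ C∈) = ∈-perSliceClusters i 1≤i (m≤n⇒m≤1+n i≤N) C∈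
  inPair-singleton (inj₂ C∈) = ∈-perSliceClusters (suc i) (s≤s z≤n) (s≤s i≤N) C∈

  inPair-¬touches-later : ∀ {C} → InPair C → ∀ j → suc i < j → ¬ T (touchesᵇ j (C ∷ []))
  inPair-¬touches-later {C} pair j 1+i<j = ¬touches pair ∘ subst (λ D → T (touchesB (border bs j) D)) (++-identityʳ C)
    where
      ¬touches : InPair C → ¬ T (touchesB (border bs j) C)
      ¬touches (inj₁ C∈) = sliceCluster-¬touches-later S bs↑ i j 1≤i (<-trans (n<1+n i) 1+i<j) C∈
      ¬touches (inj₂ C∈) = sliceCluster-¬touches-later S bs↑ (suc i) j (s≤s z≤n) 1+i<j C∈

  joinLoopAbove : ℕ → State → State
  joinLoopAbove zero    s = s
  joinLoopAbove (suc d) s = joinLoopAbove d (joinAt μ bs (suc (d + i)) s)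

  joinLoop-split : ∀ d s → joinLoop μ bs (d + i) s ≡ joinLoop μ bs i (joinLoopAbove d s)
  joinLoop-split zero    s = refl
  joinLoop-split (suc d) s = joinLoop-split d (joinAt μ bs (suc (d + i)) s)

  joinLoopAbove-touch≤ : ∀ d s → CandidatesTouch≤ (d + i) s → CandidatesTouch≤ i (joinLoopAbove d s)
  joinLoopAbove-touch≤ zero    s touch≤ = touch≤
  joinLoopAbove-touch≤ (suc d) s touch≤ = joinLoopAbove-touch≤ d _ (joinAt-touch≤ (d + i) s touch≤)

  covered-above : ∀ d s {C} → InPair C → TouchesBᵢ C → (C ∷ []) ∈ candidates s →
                  ∃[ J ] (J ∈ candidates (joinLoopAbove d s) × C ∈ J)
  covered-above zero s _ _ C∈ = _ , C∈ , here refl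
  covered-above (suc zero) s pair touches C∈ with joinAt-absorbs (suc i) s C∈
  ... | J , C∷[]⊆J , inj₁ J∈ = J , J∈ , C∷[]⊆J (here refl)
  ... | J , C∷[]⊆J , inj₂ J∈ =
    J , joinAt-returned (suc i) s J∈ (touchesB-concat (border bs i) touches (C∷[]⊆J (here refl))) , C∷[]⊆J (here refl)
  covered-above (suc (suc d)) s pair touches C∈ =
    covered-above (suc d) _ pair touches
      (joinAt-untouched (suc (suc d + i)) s C∈ (inPair-¬touches-later pair _ (s≤s (s≤s (m≤n+m i d)))))

  beforeBᵢ : State
  beforeBᵢ = joinLoopAbove (length bs ∸ i) (step1 S μ bs)

  before-Bᵢ-touch≤ : CandidatesTouch≤ i beforeBᵢ
  before-Bᵢ-touch≤ = joinLoopAbove-touch≤ (length bs ∸ i) _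
    (subst (λ n → CandidatesTouch≤ n (step1 S μ bs)) (sym (m∸n+n≡m i≤N)) step1-touch≤)

  praster≡ : praster S μ bs ≡ joinLoop μ bs i beforeBᵢ
  praster≡ = subst (λ n → joinLoop μ bs n (step1 S μ bs) ≡ joinLoop μ bs i beforeBᵢ) (m∸n+n≡m i≤N)
                   (joinLoop-split (length bs ∸ i) _)

  covered-before-Bᵢ : ∀ {C} → InPair C → TouchesBᵢ C →
                      ∃[ J ] (J ∈ filterᵇ (touchesᵇ i) (candidates beforeBᵢ) × C ∈ J)
  covered-before-Bᵢ {C} pair touches
    with covered-above (length bs ∸ i) _ pair touches
           (step1-candidate i (inPair-singleton pair) (touchesB-concat (border bs i) {J = C ∷ []} touches (here refl)))
  ... | J , J∈ , C∈J = J , ∈-filterᵇ⁺ (touchesᵇ i) J∈ (touchesB-concat (border bs i) touches C∈J) , C∈J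

  finished-after-Bᵢ : ∀ {J} → J ∈ candidates (joinAt μ bs i beforeBᵢ) ⊎ J ∈ finished (joinAt μ bs i beforeBᵢ) →
                      ∃[ F ] (F ∈ finalClusters S μ bs × J ⊆ F)
  finished-after-Bᵢ J∈ with ends-in-finished-after 1≤i beforeBᵢ before-Bᵢ-touch≤ J∈
  ... | F , F∈ , J⊆F = F , subst (F ∈_) (sym (cong finished praster≡)) F∈ , J⊆F

  module _ (Cs : List (List Tile)) (Cs-inPair : All InPair Cs) (Cs-connected : Connected (concat Cs)) where

    private
      pair : ∀ {C} → C ∈ Cs → InPair C
      pair = All.lookup Cs-inPair

    open ConnectedFamily Cs (λ C∈ C'∈ → inPair-disjoint (pair C∈) (pair C'∈)) (inPair-nonempty ∘ pair) Cs-connected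

    JoinedInFinalCluster : Set
    JoinedInFinalCluster = ∃[ F ] (F ∈ finalClusters S μ bs × All (_∈ F) Cs)

    all-equal-if-¬touching : ∀ {C₀} → C₀ ∈ Cs → ¬ TouchesBᵢ C₀ → ∀ {C} → C ∈ Cs → C ≡ C₀
    all-equal-if-¬touching {C₀} C₀∈ ¬touches = propagate (_≡ C₀) preserve C₀∈ refl
      where
        preserve : ∀ {C C' p p'} → C ∈ Cs → C' ∈ Cs → p ∈ C → p' ∈ C' → Neighbor p p' → C ≡ C₀ → C' ≡ C₀
        preserve C∈ C'∈ p∈C p'∈C' pp' refl with inPair-closed (pair C∈) (pair C'∈) p∈C p'∈C' pp'
        ... | inj₁ p'∈C₀   = inPair-disjoint (pair C'∈) (pair C∈) p'∈C' p'∈C₀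
        ... | inj₂ touches = ⊥-elim (¬touches touches)

    joined-if-¬touching : ∀ {C₀} → C₀ ∈ Cs → ¬ TouchesBᵢ C₀ → JoinedInFinalCluster
    joined-if-¬touching C₀∈ ¬touches
      with ends-in-finished (length bs) (step1 S μ bs) step1-touch≤ (step1-covers (inPair-singleton (pair C₀∈)))
    ... | F , F∈ , C₀∷[]⊆F =
      F , F∈ , tabulate λ C∈ → subst (_∈ F) (sym (all-equal-if-¬touching C₀∈ ¬touches C∈)) (C₀∷[]⊆F (here refl))

    joined-if-touching : (∀ {C} → C ∈ Cs → TouchesBᵢ C) → ∀ {C₀} → C₀ ∈ Cs → JoinedInFinalCluster
    joined-if-touching touches C₀∈ =
      let G , G∈ , Cs⊆G = within-one-component (filterᵇ (touchesᵇ i) (candidates beforeBᵢ))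
                            (λ C∈ → covered-before-Bᵢ (pair C∈) (touches C∈)) C₀∈
          F , F∈ , G⊆F  = finished-after-Bᵢ (joinAt-joined i beforeBᵢ (∈-map⁺ concat G∈))
      in F , F∈ , tabulate (λ C∈ → G⊆F (Cs⊆G C∈))

    joined-together : ∀ {C₀} → C₀ ∈ Cs → JoinedInFinalCluster
    joined-together C₀∈ with all? (T? ∘ touchesB (border bs i)) Cs
    ... | yes all-touch = joined-if-touching (All.lookup all-touch) C₀∈
    ... | no ¬all-touch with find (¬All⇒Any¬ (T? ∘ touchesB (border bs i)) Cs ¬all-touch)
    ...   | C₁ , C₁∈ , ¬touches = joined-if-¬touching C₁∈ ¬touches

theorem1 : (S : List Tile) → Unique S → (μ : ℕ) → (bs : List ℤ) → Linked ℤ._<_ bs →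
           (i : ℕ) → 1 ≤ i → i ≤ length bs →
           (Cs : List (List Tile)) → 2 ≤ length Cs →
           All (λ C → C ∈ sliceClusters S bs i ⊎ C ∈ sliceClusters S bs (suc i)) Cs →
           Connected (concat Cs) →
           ∃[ F ] (F ∈ finalClusters S μ bs × All (λ C → C ∈ F) Cs)
theorem1 S S! μ bs bs↑ i 1≤i i≤N Cs@(_ ∷ _) _ Cs-inPair Cs-connected =
  AtBorder.joined-together S S! μ bs bs↑ i 1≤i i≤N Cs Cs-inPair Cs-connected (here refl)
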